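{- Let $G$ be a connected chain graph with minimum degree at least $2$. Then $pc(G)=2$.
   Context: A bipartite graph $G(A,B)$ is a chain graph if the vertices of $A$ can be ordered as $a_1,\dots,a_k$ so that $N(a_1)\subseteq N(a_2)\subseteq\cdots\subseteq N(a_k)$, where $N(a)$ is the neighborhood of $a$. For an edge-colored graph, a path is a proper path if no two consecutive edges of the path receive the same color. An edge-coloring of a connected graph $G$ is a proper-path coloring if every pair of distinct vertices $u,v$ is joined by a proper $u$-$v$ path. The proper connection number $pc(G)$ is the minimum number of colors in a proper-path coloring of $G$. Graphs are finite and simple. -}

module Defs where

open import Data.Nat using (ℕ; zero; suc; _≤_; _<_)
open import Data.Bool using (Bool; true; false; T)
open import Data.Bool.Properties using () renaming (_≟_ to _≟ᵇ_)
open import Data.Fin using (Fin)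
import Data.Fin
open import Data.Fin.Properties using () renaming (_≟_ to _≟ᶠ_)
open import Data.List using (List; length; filter; allFin)
open import Data.Vec using (Vec; []; _∷_; head; last; toList)
open import Data.List.Relation.Unary.Unique.Propositional using (Unique)
open import Data.Product using (Σ; ∃; _×_; _,_)
open import Relation.Binary.PropositionalEquality using (_≡_; _≢_)
open import Relation.Nullary using (¬_)

record Graph (n : ℕ) : Set where
  field
    adj     : Fin n → Fin n → Bool
    sym     : ∀ u v → adj u v ≡ adj v u
    irrefl  : ∀ u → adj u u ≡ false
open Graph public

Adj : ∀ {n} → Graph n → Fin n → Fin n → Set
Adj G u v = T (adj G u v)

degree : ∀ {n} → Graph n → Fin n → ℕ
degree {n} G v = length (filter (λ w → adj G v w ≟ᵇ true) (allFin n))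

MinDegreeAtLeast : ∀ {n} → Graph n → ℕ → Set
MinDegreeAtLeast G d = ∀ v → d ≤ degree G v

IsWalk : ∀ {n m} → Graph n → Vec (Fin n) (suc m) → Set
IsWalk G (x ∷ []) = Data.Unit.⊤ where import Data.Unit
IsWalk G (x ∷ y ∷ xs) = Adj G x y × IsWalk G (y ∷ xs)

IsPath : ∀ {n m} → Graph n → Vec (Fin n) (suc m) → Set
IsPath G p = IsWalk G p × Unique (toList p)

PathBetween : ∀ {n} → Graph n → Fin n → Fin n → Set
PathBetween {n} G u v = Σ ℕ λ m → Σ (Vec (Fin n) (suc m)) λ p →
  IsPath G p × head p ≡ u × last p ≡ v

Connected : ∀ {n} → Graph n → Set
-- (graphs have a non-empty vertex set, so a connected graph has a vertex)
Connected {n} G = Fin n × (∀ (u v : Fin n) → PathBetween G u v)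

-- Bipartite graph G(A,B): side gives the bipartition (true = A, false = B);
-- every edge joins A and B.
IsBipartition : ∀ {n} → Graph n → (Fin n → Bool) → Set
IsBipartition G side = ∀ u v → Adj G u v → side u ≢ side v

NbhdSubset : ∀ {n} → Graph n → Fin n → Fin n → Set
NbhdSubset G a a' = ∀ w → Adj G a w → Adj G a' w

-- Chain graph: a bipartite graph G(A,B) whose A-side can be ordered
-- a_1,...,a_k (a bijective enumeration Fin k → A) with nested neighbourhoods.
IsChainGraph : ∀ {n} → Graph n → Set
IsChainGraph {n} G = Σ (Fin n → Bool) λ side → IsBipartition G side ×
  Σ ℕ λ k → Σ (Fin k → Fin n) λ a →
    (∀ i j → a i ≡ a j → i ≡ j) ×
    (∀ i → side (a i) ≡ true) ×
    (∀ v → side v ≡ true → ∃ λ i → a i ≡ v) ×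
    (∀ i j → i Data.Fin.≤ j → NbhdSubset G (a i) (a j))

-- Edge colouring with k colours: symmetric colour function (its values on
-- non-adjacent pairs are irrelevant).
record EdgeColoring {n} (G : Graph n) (k : ℕ) : Set where
  field
    col     : Fin n → Fin n → Fin k
    col-sym : ∀ u v → col u v ≡ col v u
open EdgeColoring public

ProperSeq : ∀ {n k m} → (Fin n → Fin n → Fin k) → Vec (Fin n) (suc m) → Set
ProperSeq c (x ∷ []) = Data.Unit.⊤ where import Data.Unit
ProperSeq c (x ∷ y ∷ []) = Data.Unit.⊤ where import Data.Unit
ProperSeq c (x ∷ y ∷ z ∷ xs) = c x y ≢ c y z × ProperSeq c (y ∷ z ∷ xs)

ProperPathBetween : ∀ {n k} (G : Graph n) → EdgeColoring G k → Fin n → Fin n → Set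
ProperPathBetween {n} G c u v = Σ ℕ λ m → Σ (Vec (Fin n) (suc m)) λ p →
  IsPath G p × ProperSeq (col c) p × head p ≡ u × last p ≡ v

IsProperPathColoring : ∀ {n k} (G : Graph n) → EdgeColoring G k → Set
IsProperPathColoring {n} G c = ∀ (u v : Fin n) → u ≢ v → ProperPathBetween G c u v

HasProperPathColoring : ∀ {n} → Graph n → ℕ → Set
HasProperPathColoring G k = Σ (EdgeColoring G k) λ c → IsProperPathColoring G c

ProperConnectionNumber : ∀ {n} → Graph n → ℕ → Set
ProperConnectionNumber G k =
  HasProperPathColoring G k × (∀ j → j < k → ¬ HasProperPathColoring G j)

-- In a chain graph of minimum degree 2 the two vertices of A with the largest
-- neighbourhoods, x and y, are adjacent to all of B, and two neighbours p, q of
-- the vertex of A with the smallest neighbourhood are adjacent to all of A.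
-- Colour an edge 1 if exactly one of its ends is a hub x or p, and 0 otherwise.
-- A path is then proper as soon as the hub status of the vertices two steps
-- apart differs, and every pair of vertices is joined by such a path of length
-- at most 4 through x, p and one of y, q.  One colour is not enough because
-- p and q lie on the same side, so a path between them has at least two edges.
module Submission where

open import Defs hiding (sym)
open import Data.Nat using (ℕ; zero; suc; _<_; z≤n; s≤s) renaming (_≤_ to _≤ℕ_)
open import Data.Bool using (Bool; true; false; T; _∨_; _xor_)
open import Data.Bool.Properties using (xor-comm; ∨-zeroʳ; ¬-not; not-¬; T-≡) renaming (_≟_ to _≟ᵇ_)
open import Data.Fin using (Fin; zero; suc; fromℕ; inject₁; _≤_)
open import Data.Fin.Properties using (≤fromℕ; fromℕ≢inject₁) renaming (_≟_ to _≟ᶠ_)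
open import Data.List using ([]; _∷_; length; filter; allFin)
open import Data.Vec using ([]; _∷_)
open import Data.List.Relation.Unary.All using (All; []; _∷_)
open import Data.List.Relation.Unary.All.Properties using (all-filter)
open import Data.List.Relation.Unary.AllPairs using ([]; _∷_)
open import Data.List.Relation.Unary.Unique.Propositional using (Unique)
open import Data.List.Relation.Unary.Unique.Propositional.Properties using (filter⁺; allFin⁺)
open import Data.Product using (Σ; ∃; _×_; _,_; proj₁; proj₂; uncurry)
open import Data.Unit using (tt)
open import Data.Empty using (⊥-elim)
open import Function.Bundles using (Equivalence)
open import Relation.Binary.PropositionalEquality using (_≡_; _≢_; refl; sym; trans; cong; subst; ≢-sym)
open import Relation.Nullary using (¬_; yes; no; does)
open import Relation.Nullary.Decidable using (dec-true; dec-false)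

false-true⇒≢ : ∀ {a b} → a ≡ false → b ≡ true → a ≢ b
false-true⇒≢ refl refl ()

module _ {n : ℕ} (G : Graph n) where

  Adj-sym : ∀ {u v} → Adj G u v → Adj G v u
  Adj-sym {u} {v} = subst T (Graph.sym G u v)

  Adj⇒≢ : ∀ {u v} → Adj G u v → u ≢ v
  Adj⇒≢ {u} a refl = subst T (irrefl G u) a

  twoNeighbours : ∀ v → 2 ≤ℕ degree G v →
    Σ (Fin n) λ w₁ → Σ (Fin n) λ w₂ → w₁ ≢ w₂ × Adj G v w₁ × Adj G v w₂
  twoNeighbours v deg =
    firstTwo (filter isNeighbour? (allFin n)) (filter⁺ isNeighbour? (allFin⁺ n))
      (all-filter isNeighbour? (allFin n)) deg
    where
    isNeighbour? = λ w → adj G v w ≟ᵇ true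
    firstTwo : ∀ ws → Unique ws → All (λ w → adj G v w ≡ true) ws → 2 ≤ℕ length ws →
      Σ (Fin n) λ w₁ → Σ (Fin n) λ w₂ → w₁ ≢ w₂ × Adj G v w₁ × Adj G v w₂
    firstTwo (w₁ ∷ w₂ ∷ _) ((w₁≢w₂ ∷ _) ∷ _) (a₁ ∷ a₂ ∷ _) _ =
      w₁ , w₂ , w₁≢w₂ , Equivalence.from T-≡ a₁ , Equivalence.from T-≡ a₂
    firstTwo []      _ _ ()
    firstTwo (_ ∷ []) _ _ (s≤s ())

module XorColouring {n : ℕ} (G : Graph n) (marked : Fin n → Bool) where

  bit : Bool → Fin 2
  bit false = zero
  bit true  = suc zero

  colouring : EdgeColoring G 2
  colouring = record
    { col     = λ u v → bit (marked u xor marked v)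
    ; col-sym = λ u v → cong bit (xor-comm (marked u) (marked v))
    }

  xor-turn : ∀ a b c → a ≢ c → bit (a xor b) ≢ bit (b xor c)
  xor-turn false _     false a≢c = ⊥-elim (a≢c refl)
  xor-turn true  _     true  a≢c = ⊥-elim (a≢c refl)
  xor-turn false false true  _ ()
  xor-turn false true  true  _ ()
  xor-turn true  false false _ ()
  xor-turn true  true  false _ ()

  turn : ∀ {u v w} → marked u ≢ marked w → col colouring u v ≢ col colouring v w
  turn {u} {v} {w} = xor-turn (marked u) (marked v) (marked w)

  marked⇒≢ : ∀ {u v} → marked u ≢ marked v → u ≢ v
  marked⇒≢ ne refl = ne refl

  -- Vertices two steps apart on a path are distinct by their marks, so only
  -- pairs further apart are required to be distinct explicitly.

  Path : Fin n → Fin n → Set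
  Path = ProperPathBetween G colouring

  edgePath : ∀ {u v} → Adj G u v → Path u v
  edgePath {u} {v} a =
    1 , (u ∷ v ∷ []) , ((a , tt) , (Adj⇒≢ G a ∷ []) ∷ [] ∷ []) , tt , refl , refl

  path₂ : ∀ {u w v} → Adj G u w → Adj G w v → marked u ≢ marked v → Path u v
  path₂ {u} {w} {v} a₁ a₂ m =
    2 , (u ∷ w ∷ v ∷ []) ,
    ((a₁ , a₂ , tt) ,
     (Adj⇒≢ G a₁ ∷ marked⇒≢ m ∷ []) ∷ (Adj⇒≢ G a₂ ∷ []) ∷ [] ∷ []) ,
    (turn m , tt) , refl , refl

  path₃ : ∀ {u w₁ w₂ v} → Adj G u w₁ → Adj G w₁ w₂ → Adj G w₂ v →
    marked u ≢ marked w₂ → marked w₁ ≢ marked v → u ≢ v → Path u v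
  path₃ {u} {w₁} {w₂} {v} a₁ a₂ a₃ m₁ m₂ u≢v =
    3 , (u ∷ w₁ ∷ w₂ ∷ v ∷ []) ,
    ((a₁ , a₂ , a₃ , tt) ,
     (Adj⇒≢ G a₁ ∷ marked⇒≢ m₁ ∷ u≢v ∷ []) ∷ (Adj⇒≢ G a₂ ∷ marked⇒≢ m₂ ∷ []) ∷
     (Adj⇒≢ G a₃ ∷ []) ∷ [] ∷ []) ,
    (turn m₁ , turn m₂ , tt) , refl , refl

  path₄ : ∀ {u w₁ w₂ w₃ v} → Adj G u w₁ → Adj G w₁ w₂ → Adj G w₂ w₃ → Adj G w₃ v →
    marked u ≢ marked w₂ → marked w₁ ≢ marked w₃ → marked w₂ ≢ marked v →
    u ≢ w₃ → w₁ ≢ v → u ≢ v → Path u v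
  path₄ {u} {w₁} {w₂} {w₃} {v} a₁ a₂ a₃ a₄ m₁ m₂ m₃ u≢w₃ w₁≢v u≢v =
    4 , (u ∷ w₁ ∷ w₂ ∷ w₃ ∷ v ∷ []) ,
    ((a₁ , a₂ , a₃ , a₄ , tt) ,
     (Adj⇒≢ G a₁ ∷ marked⇒≢ m₁ ∷ u≢w₃ ∷ u≢v ∷ []) ∷
     (Adj⇒≢ G a₂ ∷ marked⇒≢ m₂ ∷ w₁≢v ∷ []) ∷
     (Adj⇒≢ G a₃ ∷ marked⇒≢ m₃ ∷ []) ∷ (Adj⇒≢ G a₄ ∷ []) ∷ [] ∷ []) ,
    (turn m₁ , turn m₂ , turn m₃ , tt) , refl , refl

module _ {n : ℕ} (G : Graph n) (side : Fin n → Bool) where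

  Dominating : Fin n → Set
  Dominating w = ∀ v → side v ≢ side w → Adj G w v

  record DominatingPair (s : Bool) : Set where
    field
      first second        : Fin n
      first-side          : side first ≡ s
      second-side         : side second ≡ s
      distinct            : first ≢ second
      first-dominating    : Dominating first
      second-dominating   : Dominating second

module TwoDominatingPairs {n : ℕ} (G : Graph n) (side : Fin n → Bool)
  (upper : DominatingPair G side true) (lower : DominatingPair G side false) where

  open DominatingPair

  x y p q : Fin n
  x = first upper
  y = second upper
  p = first lower
  q = second lower

  marked : Fin n → Bool
  marked w = does (w ≟ᶠ x) ∨ does (w ≟ᶠ p)

  open XorColouring G marked

  sides⇒≢ : ∀ {s u w} → side u ≡ s → side w ≢ s → u ≢ w
  sides⇒≢ su sw refl = sw su

  marked-x : marked x ≡ true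
  marked-x rewrite dec-true (x ≟ᶠ x) refl = refl

  marked-p : marked p ≡ true
  marked-p rewrite dec-true (p ≟ᶠ p) refl = ∨-zeroʳ (does (p ≟ᶠ x))

  unmarked : ∀ {w} → w ≢ x → w ≢ p → marked w ≡ false
  unmarked {w} w≢x w≢p rewrite dec-false (w ≟ᶠ x) w≢x | dec-false (w ≟ᶠ p) w≢p = refl

  -- hub is the hub on side s; hub′ (the other hub) and spare′ dominate from
  -- the other side.
  record Frame (s : Bool) : Set where
    field
      hub hub′ spare′      : Fin n
      hub-side             : side hub ≡ s
      hub′-side            : side hub′ ≢ s
      spare′-side          : side spare′ ≡ side hub′
      hub′≢spare′          : hub′ ≢ spare′
      hub-dominating       : Dominating G side hub
      hub′-dominating      : Dominating G side hub′
      spare′-dominating    : Dominating G side spare′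
      hub-marked           : marked hub ≡ true
      hub′-marked          : marked hub′ ≡ true
      unmarked-frame       : ∀ {w} → w ≢ hub → w ≢ hub′ → marked w ≡ false

  frame : ∀ s → Frame s
  frame true = record
    { hub = x ; hub′ = p ; spare′ = q
    ; hub-side = first-side upper
    ; hub′-side = not-¬ (first-side lower)
    ; spare′-side = trans (second-side lower) (sym (first-side lower))
    ; hub′≢spare′ = distinct lower
    ; hub-dominating = first-dominating upper
    ; hub′-dominating = first-dominating lower
    ; spare′-dominating = second-dominating lower
    ; hub-marked = marked-x ; hub′-marked = marked-p
    ; unmarked-frame = unmarked
    }
  frame false = record
    { hub = p ; hub′ = x ; spare′ = y
    ; hub-side = first-side lower
    ; hub′-side = not-¬ (first-side upper)
    ; spare′-side = trans (second-side upper) (sym (first-side upper))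
    ; hub′≢spare′ = distinct upper
    ; hub-dominating = first-dominating lower
    ; hub′-dominating = first-dominating upper
    ; spare′-dominating = second-dominating upper
    ; hub-marked = marked-p ; hub′-marked = marked-x
    ; unmarked-frame = λ w≢p w≢x → unmarked w≢x w≢p
    }

  module _ {s : Bool} (F : Frame s) where
    open Frame F

    spare′-off : side spare′ ≢ s
    spare′-off e = hub′-side (trans (sym spare′-side) e)

    hub→ : ∀ {w} → side w ≢ s → Adj G hub w
    hub→ {w} sw = hub-dominating w (λ e → sw (trans e hub-side))

    hub′→ : ∀ {w} → side w ≡ s → Adj G hub′ w
    hub′→ {w} sw = hub′-dominating w (λ e → hub′-side (trans (sym e) sw))

    spare′→ : ∀ {w} → side w ≡ s → Adj G spare′ w
    spare′→ {w} sw = spare′-dominating w (λ e → spare′-off (trans (sym e) sw))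

    ≢hub-mark : ∀ {w} → side w ≡ s → w ≢ hub → marked w ≢ marked hub
    ≢hub-mark sw w≢hub =
      false-true⇒≢ (unmarked-frame w≢hub (sides⇒≢ sw hub′-side)) hub-marked

    ≢hub′-mark : ∀ {w} → side w ≢ s → w ≢ hub′ → marked w ≢ marked hub′
    ≢hub′-mark sw w≢hub′ =
      false-true⇒≢ (unmarked-frame (≢-sym (sides⇒≢ hub-side sw)) w≢hub′) hub′-marked

    -- The paths are hub–hub′–v and u–hub′–hub or u–hub′–hub–spare′–v within a
    -- side, and u–hub′–hub–v across.
    pathFrom : ∀ {u v} → side u ≡ s → u ≢ v → Path u v
    pathFrom {u} {v} su u≢v with side v ≟ᵇ s | u ≟ᶠ hub
    ... | yes sv | yes refl =
      path₂ (hub→ hub′-side) (hub′→ sv) (≢-sym (≢hub-mark sv (≢-sym u≢v)))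
    ... | no sv  | yes refl = edgePath (hub→ sv)
    ... | yes sv | no u≢hub with v ≟ᶠ hub
    ...   | yes refl =
      path₂ (Adj-sym G (hub′→ su)) (Adj-sym G (hub→ hub′-side)) (≢hub-mark su u≢hub)
    ...   | no v≢hub =
      path₄ (Adj-sym G (hub′→ su)) (Adj-sym G (hub→ hub′-side)) (hub→ spare′-off) (spare′→ sv)
        (≢hub-mark su u≢hub) (≢-sym (≢hub′-mark spare′-off (≢-sym hub′≢spare′)))
        (≢-sym (≢hub-mark sv v≢hub))
        (sides⇒≢ su spare′-off) (≢-sym (sides⇒≢ sv hub′-side)) u≢v
    pathFrom {u} {v} su u≢v | no sv | no u≢hub with v ≟ᶠ hub′
    ...   | yes refl = edgePath (Adj-sym G (hub′→ su))
    ...   | no v≢hub′ =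
      path₃ (Adj-sym G (hub′→ su)) (Adj-sym G (hub→ hub′-side)) (hub→ sv)
        (≢hub-mark su u≢hub) (≢-sym (≢hub′-mark sv v≢hub′)) u≢v

  hasProperPathColouring : HasProperPathColoring G 2
  hasProperPathColouring = colouring , λ u v → pathFrom (frame (side u)) refl

module _ {n : ℕ} {G : Graph n} {side : Fin n → Bool} (bip : IsBipartition G side) where

  noEdgeColouring₀ : Fin n → ¬ EdgeColoring G 0
  noEdgeColouring₀ v c with col c v v
  ... | ()

  -- With one colour a proper path has at most one edge, and edges change sides.
  noProperPath₁ : ∀ {u v} (c : EdgeColoring G 1) → side u ≡ side v → u ≢ v →
    ¬ ProperPathBetween G c u v
  noProperPath₁ c _ u≢v (0 , (_ ∷ []) , _ , _ , refl , refl) = u≢v refl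
  noProperPath₁ c su≡sv _ (1 , (u ∷ v ∷ []) , ((a , _) , _) , _ , refl , refl) = bip u v a su≡sv
  noProperPath₁ c _ _ (suc (suc _) , (u ∷ v ∷ w ∷ _) , _ , (turn , _) , _)
    with col c u v | col c v w
  ... | zero | zero = turn refl

  properConnectionNumber≡2 : ∀ u v → side u ≡ side v → u ≢ v →
    HasProperPathColoring G 2 → ProperConnectionNumber G 2
  properConnectionNumber≡2 u v su≡sv u≢v pc₂ = pc₂ , fewer
    where
    fewer : ∀ j → j < 2 → ¬ HasProperPathColoring G j
    fewer 0 _ (c , _) = noEdgeColouring₀ u c
    fewer 1 _ (c , pc) = noProperPath₁ c su≡sv u≢v (pc u v u≢v)
    fewer (suc (suc _)) (s≤s (s≤s ()))

≢fromℕ⇒≤inject₁fromℕ : ∀ {m} (i : Fin (suc (suc m))) → i ≢ fromℕ (suc m) → i ≤ inject₁ (fromℕ m)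
≢fromℕ⇒≤inject₁fromℕ zero _ = z≤n
≢fromℕ⇒≤inject₁fromℕ {zero} (suc zero) i≢top = ⊥-elim (i≢top refl)
≢fromℕ⇒≤inject₁fromℕ {suc m} (suc i) i≢top =
  s≤s (≢fromℕ⇒≤inject₁fromℕ i (λ i≡top → i≢top (cong suc i≡top)))

record ChainOrdering {n : ℕ} (G : Graph n) (side : Fin n → Bool) (k : ℕ) : Set where
  field
    vertex           : Fin k → Fin n
    vertex-injective : ∀ i j → vertex i ≡ vertex j → i ≡ j
    vertex-side      : ∀ i → side (vertex i) ≡ true
    vertex-onto      : ∀ v → side v ≡ true → ∃ λ i → vertex i ≡ v
    nested           : ∀ i j → i ≤ j → NbhdSubset G (vertex i) (vertex j)

module _ {n : ℕ} (G : Graph n) {side : Fin n → Bool}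
  (bip : IsBipartition G side) (δ : MinDegreeAtLeast G 2) where

  offSideVertex : Fin n → ∀ s → ∃ λ w → side w ≢ s
  offSideVertex v s with side v ≟ᵇ s
  ... | no sv  = v , sv
  ... | yes sv with twoNeighbours G v (δ v)
  ...   | w , _ , _ , a , _ = w , λ sw → bip v w a (trans sv (sym sw))

  module _ {k : ℕ} (O : ChainOrdering G side k) where
    open ChainOrdering O

    neighbourIndex : ∀ {b w} → side b ≢ true → Adj G b w →
      Σ (Fin k) λ i → vertex i ≡ w × Adj G (vertex i) b
    neighbourIndex {b} sb a with vertex-onto _ (¬-not (λ sw → bip b _ a (trans (¬-not sb) (sym sw))))
    ... | i , refl = i , refl , Adj-sym G a

    neighbourIndices : ∀ b → side b ≢ true →
      Σ (Fin k) λ i → Σ (Fin k) λ j → i ≢ j × Adj G (vertex i) b × Adj G (vertex j) b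
    neighbourIndices b sb with twoNeighbours G b (δ b)
    ... | w₁ , w₂ , w₁≢w₂ , a₁ , a₂ with neighbourIndex sb a₁ | neighbourIndex sb a₂
    ...   | i , refl , aᵢ | j , refl , aⱼ = i , j , (λ i≡j → w₁≢w₂ (cong vertex i≡j)) , aᵢ , aⱼ

  upperPair : ∀ {m} → ChainOrdering G side (suc (suc m)) → DominatingPair G side true
  upperPair {m} O = record
    { first = vertex top ; second = vertex belowTop
    ; first-side = vertex-side top ; second-side = vertex-side belowTop
    ; distinct = λ e → fromℕ≢inject₁ (vertex-injective top belowTop e)
    ; first-dominating = top-dominating
    ; second-dominating = belowTop-dominating
    }
    where
    open ChainOrdering O
    top belowTop : Fin (suc (suc m))
    top = fromℕ (suc m)
    belowTop = inject₁ (fromℕ m)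

    offA : ∀ {i v} → side v ≢ side (vertex i) → side v ≢ true
    offA {i} sv e = sv (trans e (sym (vertex-side i)))

    top-dominating : Dominating G side (vertex top)
    top-dominating v sv with neighbourIndices O v (offA sv)
    ... | i , _ , _ , a , _ = nested i top (≤fromℕ i) v a

    -- Of the two distinct A-neighbours of v, at least one is not a_k.
    belowTop-dominating : Dominating G side (vertex belowTop)
    belowTop-dominating v sv with neighbourIndices O v (offA sv)
    ... | i , j , i≢j , aᵢ , aⱼ with i ≟ᶠ top
    ...   | no i≢top = nested i belowTop (≢fromℕ⇒≤inject₁fromℕ i i≢top) v aᵢ
    ...   | yes refl = nested j belowTop (≢fromℕ⇒≤inject₁fromℕ j (≢-sym i≢j)) v aⱼ

  lowerPair : ∀ {m} → ChainOrdering G side (suc m) → DominatingPair G side false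
  lowerPair O with twoNeighbours G (ChainOrdering.vertex O zero) (δ _)
  ... | p , q , p≢q , aₚ , a_q = record
    { first = p ; second = q
    ; first-side = onB aₚ ; second-side = onB a_q
    ; distinct = p≢q
    ; first-dominating = dominating aₚ ; second-dominating = dominating a_q
    }
    where
    open ChainOrdering O
    onB : ∀ {w} → Adj G (vertex zero) w → side w ≡ false
    onB a = ¬-not (λ sw → bip _ _ a (trans (vertex-side zero) (sym sw)))

    dominating : ∀ {w} → Adj G (vertex zero) w → Dominating G side w
    dominating {w} a v sv with vertex-onto v (¬-not (λ e → sv (trans e (sym (onB a)))))
    ... | i , refl = Adj-sym G (nested zero i z≤n w a)

  dominatingPairs : ∀ {k} → ChainOrdering G side k → ∀ b → side b ≢ true →
    DominatingPair G side true × DominatingPair G side false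
  dominatingPairs {zero} O b sb with neighbourIndices O b sb
  ... | () , _
  dominatingPairs {suc zero} O b sb with neighbourIndices O b sb
  ... | zero , zero , i≢j , _ = ⊥-elim (i≢j refl)
  dominatingPairs {suc (suc m)} O b sb = upperPair O , lowerPair O

corollary3p2 : ∀ {n : ℕ} (G : Graph n) → Connected G → IsChainGraph G →
    MinDegreeAtLeast G 2 → ProperConnectionNumber G 2
corollary3p2 G (v , _) (side , bip , k , a , a-injective , a-side , a-onto , nested) δ =
  properConnectionNumber≡2 bip p q (trans p-side (sym q-side)) p≢q
    (TwoDominatingPairs.hasProperPathColouring G side upper lower)
  where
  ordering : ChainOrdering G side k
  ordering = record
    { vertex = a ; vertex-injective = a-injective ; vertex-side = a-side
    ; vertex-onto = a-onto ; nested = nested }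

  pairs : DominatingPair G side true × DominatingPair G side false
  pairs = uncurry (dominatingPairs G bip δ ordering) (offSideVertex G bip δ v true)

  upper : DominatingPair G side true
  upper = proj₁ pairs

  lower : DominatingPair G side false
  lower = proj₂ pairs

  open DominatingPair lower
    renaming (first to p; second to q; first-side to p-side; second-side to q-side; distinct to p≢q)
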